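{- Let $k\ge2$ and let $A$ be a $k\times k$ strictly upper triangular matrix of integers. Let $P_A$ be the set of integer sequences $\lambda=(\lambda_1,\ldots,\lambda_k)$ satisfying $\lambda_i \ge \sum_{j=i+1}^{k} A[i,j]\lambda_j$ for $1\le i\le k$, and assume every element of $P_A$ has all entries nonnegative. Let $P_{A,=}(n,k)$ be the set of $\lambda\in P_A$ of weight $\lambda_1+\cdots+\lambda_k=n$ with $\lambda_1=\sum_{j=2}^{k}A[1,j]\lambda_j$. Then \[\sum_{n\ge0}|P_{A,=}(n,k)|\,q^n=\prod_{i=2}^{k}\frac{1}{1-q^{b_i}},\] where $b_i=\sum_j B[j,i]$ is the $i$-th column sum of $B=(I-A)^{ -1}$.
   Context: A strictly upper triangular matrix $A$ has $A[i,j]=0$ for $i\ge j$; $I$ is the identity matrix. -}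

module Defs where

open import Data.Nat as ℕ using (ℕ; zero; suc)
open import Data.Integer using (ℤ; +_; _+_; _-_; _*_; _≤_; ∣_∣)
open import Data.Fin using (Fin; zero; suc; toℕ; _<?_; _≟_)
open import Data.Vec using (Vec; lookup)
open import Data.Bool using (if_then_else_)
open import Data.Nat.Divisibility using (_∣?_)
open import Relation.Nullary using (does)
open import Relation.Binary.PropositionalEquality using (_≡_)
open import Data.Product using (_×_)

sumFin : ∀ {n} → (Fin n → ℤ) → ℤ
sumFin {zero}  f = + 0
sumFin {suc n} f = f zero + sumFin (λ j → f (suc j))

sumAbove : ∀ {n} → Fin n → (Fin n → ℤ) → ℤ
sumAbove i f = sumFin (λ j → if does (i <? j) then f j else + 0)

Mat : ℕ → Set
Mat k = Fin k → Fin k → ℤ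

StrictlyUpper : ∀ {k} → Mat k → Set
StrictlyUpper {k} A = ∀ (i j : Fin k) → toℕ j ℕ.≤ toℕ i → A i j ≡ + 0

idMat : ∀ {k} → Mat k
idMat i j = if does (i ≟ j) then + 1 else + 0

_-ᴹ_ : ∀ {k} → Mat k → Mat k → Mat k
(A -ᴹ B) i j = A i j - B i j

_*ᴹ_ : ∀ {k} → Mat k → Mat k → Mat k
(A *ᴹ B) i j = sumFin (λ l → A i l * B l j)

IsInverse : ∀ {k} → Mat k → Mat k → Set
IsInverse M B = (∀ i j → (M *ᴹ B) i j ≡ idMat i j) × (∀ i j → (B *ᴹ M) i j ≡ idMat i j)

colSum : ∀ {k} → Mat k → Fin k → ℤ
colSum B i = sumFin (λ j → B j i)

InPA : ∀ {k} → Mat k → Vec ℤ k → Set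
InPA A lam = ∀ i → sumAbove i (λ j → A i j * lookup lam j) ≤ lookup lam i

-- λ ∈ P_{A,=}(n,k) (k ≥ 1; first index is zero).
InPAeq : ∀ {k} → Mat (suc k) → ℕ → Vec ℤ (suc k) → Set
InPAeq A n lam =
  InPA A lam
  × sumFin (lookup lam) ≡ + n
  × lookup lam zero ≡ sumAbove zero (λ j → A zero j * lookup lam j)

-- Formal power series over ℤ in q: coefficient sequences.
FPS : Set
FPS = ℕ → ℤ

oneS : FPS
oneS zero    = + 1
oneS (suc _) = + 0

_⊛_ : FPS → FPS → FPS
(f ⊛ g) n = sumFin {suc n} (λ i → f (toℕ i) * g (n ℕ.∸ toℕ i))

prodFinS : ∀ {n} → (Fin n → FPS) → FPS
prodFinS {zero}  F = oneS
prodFinS {suc n} F = F zero ⊛ prodFinS (λ i → F (suc i))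

-- 1/(1 - q^b) = Σ_{m ≥ 0} q^{b m}  (intended for b ≥ 1):
-- coefficient of q^n is 1 if b ∣ n, else 0.
geomS : ℕ → FPS
geomS b n = if does (b ∣? n) then + 1 else + 0

-- The slack μ = (I − A)λ of λ measures by how much each defining inequality of P_A
-- is strict. As B = (I − A)⁻¹, the map μ ↦ Bμ inverts λ ↦ μ, so P_A corresponds to the
-- nonnegative integer vectors μ, and the weight of Bμ is Σⱼ bⱼ μⱼ with bⱼ the column
-- sums of B. Each column of B has a unit vector as slack, hence lies in P_A; so B ≥ 0
-- and bⱼ ≥ 1. The extra equation defining P_{A,=}(n,k) says μ₁ = 0, so P_{A,=}(n,k) is in
-- bijection with the solutions of b₂μ₂ + ⋯ + b_kμ_k = n, whose number is the coefficient
-- of qⁿ in the product of the geometric series 1/(1 − q^{bᵢ}).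
module Submission where

open import Defs
open import Data.Nat as ℕ using (ℕ; zero; suc; _∸_; NonZero; s≤s)
import Data.Nat.Properties as ℕₚ
open import Data.Nat.Divisibility using (_∣?_; divides)
open import Data.Integer using (ℤ; +_; _+_; _-_; _*_; _≤_; +≤+; ∣_∣; 0ℤ; 1ℤ)
import Data.Integer.Properties as ℤₚ
open import Data.Integer.Tactic.RingSolver using (solve-∀)
open import Data.Fin using (Fin; zero; suc; toℕ; fromℕ<; _<?_; _≟_)
import Data.Fin.Properties as Finₚ
open import Data.Vec using (Vec; []; _∷_; lookup; tabulate)
import Data.Vec.Properties as Vecₚ
open import Data.List as List using (List; []; _∷_; _++_; [_]; concat; length)
import Data.List.Properties as Listₚ
open import Data.List.Membership.Propositional using (_∈_)
open import Data.List.Membership.Propositional.Properties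
  using (∈-map⁺; ∈-map⁻; ∈-concat⁺′; ∈-concat⁻′; ∈-tabulate⁺; ∈-tabulate⁻)
open import Data.List.Membership.Propositional.Properties.WithK using (unique∧set⇒bag)
open import Data.List.Relation.Unary.Any using (here)
open import Data.List.Relation.Unary.All using ([])
import Data.List.Relation.Unary.All.Properties as Allₚ
import Data.List.Relation.Unary.AllPairs.Properties as AllPairsₚ
open import Data.List.Relation.Unary.Unique.Propositional using (Unique; []; _∷_)
import Data.List.Relation.Unary.Unique.Propositional.Properties as Uniqueₚ
open import Data.List.Relation.Binary.Disjoint.Propositional using (Disjoint)
open import Data.List.Relation.Binary.BagAndSetEquality using (∼bag⇒↭)
open import Data.List.Relation.Binary.Permutation.Propositional.Properties using (↭-length)
open import Data.Bool using (true; false; if_then_else_)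
open import Data.Product using (_×_; _,_; proj₁; proj₂; ∃)
open import Function using (_∘_; flip; _⇔_; mk⇔; Equivalence)
import Function.Properties.Equivalence as ⇔
open import Relation.Nullary using (Dec; yes; no; does; ¬_; contradiction)
open import Relation.Binary.PropositionalEquality hiding ([_])
open import Algebra.Properties.Semiring.Sum ℤₚ.+-*-semiring
  using (sum; sum-cong-≗; sum-replicate-zero; ∑-comm; *-distribˡ-sum; *-distribʳ-sum)
open ≡-Reasoning

sumFin≡sum : ∀ {n} (f : Fin n → ℤ) → sumFin f ≡ sum f
sumFin≡sum {zero}  f = refl
sumFin≡sum {suc n} f = cong (_+_ (f zero)) (sumFin≡sum (f ∘ suc))

sumFin-cong : ∀ {n} {f g : Fin n → ℤ} → f ≗ g → sumFin f ≡ sumFin g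
sumFin-cong {f = f} {g} f≗g = begin
  sumFin f ≡⟨ sumFin≡sum f ⟩
  sum f    ≡⟨ sum-cong-≗ f≗g ⟩
  sum g    ≡⟨ sumFin≡sum g ⟨
  sumFin g ∎

sumFin-zero : ∀ n → sumFin {n} (λ _ → 0ℤ) ≡ 0ℤ
sumFin-zero n = trans (sumFin≡sum {n} (λ _ → 0ℤ)) (sum-replicate-zero n)

sumFin-comm : ∀ {m n} (f : Fin m → Fin n → ℤ) →
              sumFin (λ i → sumFin (f i)) ≡ sumFin (λ j → sumFin (λ i → f i j))
sumFin-comm f = begin
  sumFin (λ i → sumFin (f i))         ≡⟨ sumFin²≡sum² f ⟩
  sum (λ i → sum (f i))               ≡⟨ ∑-comm f ⟩
  sum (λ j → sum (λ i → f i j))       ≡⟨ sumFin²≡sum² (flip f) ⟨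
  sumFin (λ j → sumFin (λ i → f i j)) ∎
  where
  sumFin²≡sum² : ∀ {m n} (g : Fin m → Fin n → ℤ) →
                 sumFin (λ i → sumFin (g i)) ≡ sum (λ i → sum (g i))
  sumFin²≡sum² g = trans (sumFin≡sum (λ i → sumFin (g i))) (sum-cong-≗ (sumFin≡sum ∘ g))

*-distribˡ-sumFin : ∀ {n} x (f : Fin n → ℤ) → x * sumFin f ≡ sumFin (λ i → x * f i)
*-distribˡ-sumFin x f = begin
  x * sumFin f           ≡⟨ cong (x *_) (sumFin≡sum f) ⟩
  x * sum f              ≡⟨ *-distribˡ-sum x f ⟩
  sum (λ i → x * f i)    ≡⟨ sumFin≡sum (λ i → x * f i) ⟨
  sumFin (λ i → x * f i) ∎

*-distribʳ-sumFin : ∀ {n} x (f : Fin n → ℤ) → sumFin f * x ≡ sumFin (λ i → f i * x)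
*-distribʳ-sumFin x f = begin
  sumFin f * x           ≡⟨ cong (_* x) (sumFin≡sum f) ⟩
  sum f * x              ≡⟨ *-distribʳ-sum x f ⟩
  sum (λ i → f i * x)    ≡⟨ sumFin≡sum (λ i → f i * x) ⟨
  sumFin (λ i → f i * x) ∎

sumFin-sub : ∀ {n} (f g : Fin n → ℤ) → sumFin (λ i → f i - g i) ≡ sumFin f - sumFin g
sumFin-sub {zero}  f g = refl
sumFin-sub {suc n} f g = trans (cong (_+_ (f zero - g zero)) (sumFin-sub (f ∘ suc) (g ∘ suc)))
                               (interchange (f zero) (g zero) _ _)
  where
  interchange : ∀ a b c d → (a - b) + (c - d) ≡ (a + c) - (b + d)
  interchange = solve-∀

sumFin-nonneg : ∀ {n} {f : Fin n → ℤ} → (∀ i → 0ℤ ≤ f i) → 0ℤ ≤ sumFin f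
sumFin-nonneg {zero}  f≥0 = +≤+ ℕ.z≤n
sumFin-nonneg {suc n} f≥0 = ℤₚ.+-mono-≤ (f≥0 zero) (sumFin-nonneg (f≥0 ∘ suc))

≤-sumFin : ∀ {n} {f : Fin n → ℤ} → (∀ i → 0ℤ ≤ f i) → ∀ i → f i ≤ sumFin f
≤-sumFin {suc n} {f} f≥0 zero =
  subst (_≤ sumFin f) (ℤₚ.+-identityʳ (f zero)) (ℤₚ.+-monoʳ-≤ (f zero) (sumFin-nonneg (f≥0 ∘ suc)))
≤-sumFin {suc n} {f} f≥0 (suc i) =
  subst (_≤ sumFin f) (ℤₚ.+-identityˡ (f (suc i))) (ℤₚ.+-mono-≤ (f≥0 zero) (≤-sumFin (f≥0 ∘ suc) i))

sumFin≡0⇒≡0 : ∀ {n} {f : Fin n → ℤ} → (∀ i → 0ℤ ≤ f i) → sumFin f ≡ 0ℤ → ∀ i → f i ≡ 0ℤ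
sumFin≡0⇒≡0 f≥0 Σf≡0 i = ℤₚ.≤-antisym (subst (_ ≤_) Σf≡0 (≤-sumFin f≥0 i)) (f≥0 i)

infixr 7 _*ᵥ_

_*ᵥ_ : ∀ {k} → Mat k → (Fin k → ℤ) → Fin k → ℤ
(M *ᵥ x) i = sumFin (λ l → M i l * x l)

*ᵥ-cong : ∀ {k} (M : Mat k) {x y : Fin k → ℤ} → x ≗ y → M *ᵥ x ≗ M *ᵥ y
*ᵥ-cong M x≗y i = sumFin-cong (λ l → cong (M i l *_) (x≗y l))

*ᵥ-assoc : ∀ {k} (M N : Mat k) x → M *ᵥ N *ᵥ x ≗ (M *ᴹ N) *ᵥ x
*ᵥ-assoc M N x i = begin
  sumFin (λ l → M i l * sumFin (λ j → N l j * x j))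
    ≡⟨ sumFin-cong (λ l → trans (*-distribˡ-sumFin (M i l) (λ j → N l j * x j))
                                 (sumFin-cong (λ j → sym (ℤₚ.*-assoc (M i l) (N l j) (x j))))) ⟩
  sumFin (λ l → sumFin (λ j → M i l * N l j * x j))
    ≡⟨ sumFin-comm (λ l j → M i l * N l j * x j) ⟩
  sumFin (λ j → sumFin (λ l → M i l * N l j * x j))
    ≡⟨ sumFin-cong (λ j → *-distribʳ-sumFin (x j) (λ l → M i l * N l j)) ⟨
  ((M *ᴹ N) *ᵥ x) i ∎

idMat-*ᵥ : ∀ {k} (x : Fin k → ℤ) → idMat *ᵥ x ≗ x
idMat-*ᵥ {suc k} x zero = begin
  1ℤ * x zero + sumFin {k} (λ _ → 0ℤ) ≡⟨ cong₂ _+_ (ℤₚ.*-identityˡ (x zero)) (sumFin-zero k) ⟩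
  x zero + 0ℤ                         ≡⟨ ℤₚ.+-identityʳ (x zero) ⟩
  x zero                              ∎
idMat-*ᵥ {suc k} x (suc i) = trans (ℤₚ.+-identityˡ _) (idMat-*ᵥ (x ∘ suc) i)

idMat-nonneg : ∀ {k} (i j : Fin k) → 0ℤ ≤ idMat i j
idMat-nonneg i j with does (i ≟ j)
... | true  = +≤+ ℕ.z≤n
... | false = +≤+ ℕ.z≤n

idMat-diagonal : ∀ {k} (j : Fin k) → idMat j j ≡ 1ℤ
idMat-diagonal zero    = refl
idMat-diagonal (suc j) = idMat-diagonal j

*ᵥ-inverse : ∀ {k} (M N : Mat k) → (∀ i j → (M *ᴹ N) i j ≡ idMat i j) → ∀ x → M *ᵥ N *ᵥ x ≗ x
*ᵥ-inverse M N MN≡I x i = begin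
  (M *ᵥ N *ᵥ x) i   ≡⟨ *ᵥ-assoc M N x i ⟩
  ((M *ᴹ N) *ᵥ x) i ≡⟨ sumFin-cong (λ l → cong (_* x l) (MN≡I i l)) ⟩
  (idMat *ᵥ x) i    ≡⟨ idMat-*ᵥ x i ⟩
  x i               ∎

-ᴹ-*ᵥ : ∀ {k} (M N : Mat k) x i → ((M -ᴹ N) *ᵥ x) i ≡ (M *ᵥ x) i - (N *ᵥ x) i
-ᴹ-*ᵥ M N x i = trans (sumFin-cong (λ l → *-distribʳ-sub (M i l) (N i l) (x l)))
                      (sumFin-sub (λ l → M i l * x l) (λ l → N i l * x l))
  where
  *-distribʳ-sub : ∀ a b c → (a - b) * c ≡ a * c - b * c
  *-distribʳ-sub = solve-∀

sumFin-*ᵥ : ∀ {k} (M : Mat k) x → sumFin (M *ᵥ x) ≡ sumFin (λ j → colSum M j * x j)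
sumFin-*ᵥ M x = trans (sumFin-comm (λ i j → M i j * x j))
                      (sumFin-cong (λ j → sym (*-distribʳ-sumFin (x j) (λ i → M i j))))

strictlyUpper-*ᵥ : ∀ {k} {A : Mat k} → StrictlyUpper A →
                   ∀ x i → (A *ᵥ x) i ≡ sumAbove i (λ j → A i j * x j)
strictlyUpper-*ᵥ {A = A} A-upper x i =
  sumFin-cong (λ j → vanishing-outside (i <? j) (λ i≮j → cong (_* x j) (A-upper i j (ℕₚ.≮⇒≥ i≮j))))
  where
  vanishing-outside : ∀ {P : Set} (P? : Dec P) {a : ℤ} → (¬ P → a ≡ 0ℤ) → a ≡ (if does P? then a else 0ℤ)
  vanishing-outside (yes _) _    = refl
  vanishing-outside (no ¬p) a≡0 = a≡0 ¬p

slack : ∀ {k} → Mat k → Vec ℤ k → Fin k → ℤ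
slack A lam = (idMat -ᴹ A) *ᵥ lookup lam

slack≡lookup-sumAbove : ∀ {k} {A : Mat k} → StrictlyUpper A →
         ∀ lam i → slack A lam i ≡ lookup lam i - sumAbove i (λ j → A i j * lookup lam j)
slack≡lookup-sumAbove {A = A} A-upper lam i =
  trans (-ᴹ-*ᵥ idMat A (lookup lam) i)
        (cong₂ _-_ (idMat-*ᵥ (lookup lam) i) (strictlyUpper-*ᵥ A-upper (lookup lam) i))

inPA⇔slack-nonneg : ∀ {k} {A : Mat k} → StrictlyUpper A →
                    ∀ lam → InPA A lam ⇔ (∀ i → 0ℤ ≤ slack A lam i)
inPA⇔slack-nonneg A-upper lam = mk⇔
  (λ inPA i → subst (0ℤ ≤_) (sym (slack≡lookup-sumAbove A-upper lam i)) (ℤₚ.i≤j⇒0≤j-i (inPA i)))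
  (λ slack≥0 i → ℤₚ.0≤i-j⇒j≤i (subst (0ℤ ≤_) (slack≡lookup-sumAbove A-upper lam i) (slack≥0 i)))

inPAeq⇔slack : ∀ {k} {A : Mat (suc k)} → StrictlyUpper A → ∀ n lam →
               InPAeq A n lam ⇔
                 ((∀ i → 0ℤ ≤ slack A lam i) × sumFin (lookup lam) ≡ + n × slack A lam zero ≡ 0ℤ)
inPAeq⇔slack A-upper n lam = mk⇔
  (λ (inPA , weight , tight) →
     Equivalence.to (inPA⇔slack-nonneg A-upper lam) inPA , weight ,
     trans (slack≡lookup-sumAbove A-upper lam zero) (ℤₚ.i≡j⇒i-j≡0 tight))
  (λ (slack≥0 , weight , slack₀≡0) →
     Equivalence.from (inPA⇔slack-nonneg A-upper lam) slack≥0 , weight ,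
     ℤₚ.i-j≡0⇒i≡j _ _ (trans (sym (slack≡lookup-sumAbove A-upper lam zero)) slack₀≡0))

unique∧set⇒length≡ : ∀ {X : Set} {xs ys : List X} → Unique xs → Unique ys →
                     (∀ {x} → x ∈ xs ⇔ x ∈ ys) → length xs ≡ length ys
unique∧set⇒length≡ xs! ys! xs∼ys = ↭-length (∼bag⇒↭ (unique∧set⇒bag xs! ys! xs∼ys))

length-concat-tabulate : ∀ {n} {X : Set} (f : Fin n → List X) →
                         + length (concat (List.tabulate f)) ≡ sumFin (λ i → + length (f i))
length-concat-tabulate {zero}  f = refl
length-concat-tabulate {suc n} f = begin
  + length (f zero ++ concat (List.tabulate (f ∘ suc)))
    ≡⟨ cong +_ (Listₚ.length-++ (f zero)) ⟩
  + (length (f zero) ℕ.+ length (concat (List.tabulate (f ∘ suc))))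
    ≡⟨ ℤₚ.pos-+ (length (f zero)) _ ⟩
  + length (f zero) + + length (concat (List.tabulate (f ∘ suc)))
    ≡⟨ cong (_+_ (+ length (f zero))) (length-concat-tabulate (f ∘ suc)) ⟩
  sumFin (λ i → + length (f i)) ∎

weightedSum : ∀ {k} → (Fin k → ℕ) → Vec ℕ k → ℕ
weightedSum b []      = 0
weightedSum b (q ∷ v) = b zero ℕ.* q ℕ.+ weightedSum (b ∘ suc) v

+weightedSum : ∀ {k} (b : Fin k → ℕ) v → + weightedSum b v ≡ sumFin (λ j → + b j * + lookup v j)
+weightedSum b []      = refl
+weightedSum b (q ∷ v) = begin
  + (b zero ℕ.* q ℕ.+ weightedSum (b ∘ suc) v)
    ≡⟨ ℤₚ.pos-+ (b zero ℕ.* q) _ ⟩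
  + (b zero ℕ.* q) + + weightedSum (b ∘ suc) v
    ≡⟨ cong₂ _+_ (ℤₚ.pos-* (b zero) q) (+weightedSum (b ∘ suc) v) ⟩
  sumFin (λ j → + b j * + lookup (q ∷ v) j) ∎

prependQuotient : ∀ {k} → ℕ → ℕ → List (Vec ℕ k) → List (Vec ℕ (suc k))
prependQuotient b t vs with b ∣? t
... | yes (divides q _) = List.map (q ∷_) vs
... | no _              = []

solutions : ∀ {k} → (Fin k → ℕ) → ℕ → List (Vec ℕ k)

solutionsWithFirstTerm : ∀ {k} → (Fin (suc k) → ℕ) → (n : ℕ) → Fin (suc n) → List (Vec ℕ (suc k))
solutionsWithFirstTerm b n t = prependQuotient (b zero) (toℕ t) (solutions (b ∘ suc) (n ∸ toℕ t))

solutions {zero}  b zero    = [ [] ]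
solutions {zero}  b (suc n) = []
solutions {suc k} b n       = concat (List.tabulate (solutionsWithFirstTerm b n))

length-prependQuotient : ∀ {k} b t (vs : List (Vec ℕ k)) →
                         + length (prependQuotient b t vs) ≡ geomS b t * + length vs
length-prependQuotient b t vs with b ∣? t
... | yes (divides q _) = trans (cong +_ (Listₚ.length-map (q ∷_) vs)) (sym (ℤₚ.*-identityˡ _))
... | no _              = refl

∈-prependQuotient⁻ : ∀ {k} b t (vs : List (Vec ℕ k)) {q v} →
                     q ∷ v ∈ prependQuotient b t vs → q ℕ.* b ≡ t × v ∈ vs
∈-prependQuotient⁻ b t vs qv∈ with b ∣? t
... | yes (divides q t≡qb) with ∈-map⁻ (q ∷_) qv∈
...   | v , v∈vs , refl = sym t≡qb , v∈vs

∈-prependQuotient⁺ : ∀ {k} b t (vs : List (Vec ℕ k)) {q v} .{{_ : NonZero b}} →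
                     q ℕ.* b ≡ t → v ∈ vs → q ∷ v ∈ prependQuotient b t vs
∈-prependQuotient⁺ b t vs {q} qb≡t v∈vs with b ∣? t
... | yes (divides q′ t≡q′b) rewrite ℕₚ.*-cancelʳ-≡ q q′ b (trans qb≡t t≡q′b) =
  ∈-map⁺ (q′ ∷_) v∈vs
... | no b∤t = contradiction (divides q (sym qb≡t)) b∤t

prependQuotient-unique : ∀ {k} b t {vs : List (Vec ℕ k)} → Unique vs → Unique (prependQuotient b t vs)
prependQuotient-unique b t vs! with b ∣? t
... | yes (divides q _) = Uniqueₚ.map⁺ Vecₚ.∷-injectiveʳ vs!
... | no _              = []

length-solutions : ∀ {k} (b : Fin k → ℕ) n → + length (solutions b n) ≡ prodFinS (geomS ∘ b) n
length-solutions {zero}  b zero    = refl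
length-solutions {zero}  b (suc n) = refl
length-solutions {suc k} b n = trans (length-concat-tabulate (solutionsWithFirstTerm b n))
  (sumFin-cong {suc n} λ t → trans (length-prependQuotient (b zero) (toℕ t) (solutions (b ∘ suc) (n ∸ toℕ t)))
                           (cong (geomS (b zero) (toℕ t) *_) (length-solutions (b ∘ suc) (n ∸ toℕ t))))

solutions-unique : ∀ {k} (b : Fin k → ℕ) n → Unique (solutions b n)
solutions-unique {zero}  b zero    = [] ∷ []
solutions-unique {zero}  b (suc n) = []
solutions-unique {suc k} b n = Uniqueₚ.concat⁺
  (Allₚ.tabulate⁺ λ t → prependQuotient-unique (b zero) (toℕ t) (solutions-unique (b ∘ suc) (n ∸ toℕ t)))
  (AllPairsₚ.tabulate⁺ disjoint)
  where
  disjoint : ∀ {s t} → s ≢ t → Disjoint (solutionsWithFirstTerm b n s) (solutionsWithFirstTerm b n t)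
  disjoint {s} {t} s≢t {_ ∷ _} (∈s , ∈t) = s≢t (Finₚ.toℕ-injective
    (trans (sym (proj₁ (∈-prependQuotient⁻ (b zero) (toℕ s) _ ∈s)))
           (proj₁ (∈-prependQuotient⁻ (b zero) (toℕ t) _ ∈t))))

∈-solutions⁻ : ∀ {k} (b : Fin k → ℕ) n {v} → v ∈ solutions b n → weightedSum b v ≡ n
∈-solutions⁻ {zero}  b zero {[]} _ = refl
∈-solutions⁻ {suc k} b n {q ∷ v} qv∈ with ∈-concat⁻′ (List.tabulate (solutionsWithFirstTerm b n)) qv∈
... | _ , qv∈slice , slice∈ with ∈-tabulate⁻ {f = solutionsWithFirstTerm b n} slice∈
...   | t , refl with ∈-prependQuotient⁻ (b zero) (toℕ t) _ qv∈slice
...     | qb≡t , v∈ = begin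
  b zero ℕ.* q ℕ.+ weightedSum (b ∘ suc) v
    ≡⟨ cong₂ ℕ._+_ (trans (ℕₚ.*-comm (b zero) q) qb≡t) (∈-solutions⁻ (b ∘ suc) (n ∸ toℕ t) v∈) ⟩
  toℕ t ℕ.+ (n ∸ toℕ t)
    ≡⟨ ℕₚ.m+[n∸m]≡n (Finₚ.toℕ≤pred[n] t) ⟩
  n ∎

∈-solutions⁺ : ∀ {k} (b : Fin k → ℕ) → (∀ i → NonZero (b i)) →
               ∀ {n} v → weightedSum b v ≡ n → v ∈ solutions b n
∈-solutions⁺ {zero}  b b≢0 [] refl = here refl
∈-solutions⁺ {suc k} b b≢0 (q ∷ v) refl =
  ∈-concat⁺′ (∈-prependQuotient⁺ (b zero) (toℕ t) _ {{b≢0 zero}} qb≡t v∈)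
             (∈-tabulate⁺ {f = solutionsWithFirstTerm b _} t)
  where
  w = weightedSum (b ∘ suc) v
  t : Fin (suc (b zero ℕ.* q ℕ.+ w))
  t = fromℕ< (s≤s (ℕₚ.m≤m+n (b zero ℕ.* q) w))
  toℕ-t : toℕ t ≡ b zero ℕ.* q
  toℕ-t = Finₚ.toℕ-fromℕ< _
  qb≡t : q ℕ.* b zero ≡ toℕ t
  qb≡t = trans (ℕₚ.*-comm q (b zero)) (sym toℕ-t)
  v∈ : v ∈ solutions (b ∘ suc) (b zero ℕ.* q ℕ.+ w ∸ toℕ t)
  v∈ = ∈-solutions⁺ (b ∘ suc) (b≢0 ∘ suc) v
         (sym (trans (cong (b zero ℕ.* q ℕ.+ w ∸_) toℕ-t) (ℕₚ.m+n∸m≡n (b zero ℕ.* q) w)))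

module _ {k} (A B : Mat k) (A-upper : StrictlyUpper A) (B-inverse : IsInverse (idMat -ᴹ A) B)
         (P-nonneg : ∀ lam → InPA A lam → ∀ i → 0ℤ ≤ lookup lam i) where

  inverse-nonneg : ∀ l j → 0ℤ ≤ B l j
  inverse-nonneg l j =
    subst (0ℤ ≤_) (Vecₚ.lookup∘tabulate column l) (P-nonneg (tabulate column) column∈P l)
    where
    column : Fin k → ℤ
    column l = B l j
    column∈P : InPA A (tabulate column)
    column∈P = Equivalence.from (inPA⇔slack-nonneg A-upper (tabulate column)) λ i →
      subst (0ℤ ≤_)
            (sym (trans (*ᵥ-cong (idMat -ᴹ A) (Vecₚ.lookup∘tabulate column) i) (proj₁ B-inverse i j)))
            (idMat-nonneg i j)

  colSum-positive : ∀ j → 1ℤ ≤ colSum B j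
  colSum-positive j =
    ℤₚ.i<j⇒suc[i]≤j (ℤₚ.≤∧≢⇒< (sumFin-nonneg (λ l → inverse-nonneg l j)) (colSum≢0 ∘ sym))
    where
    colSum≢0 : colSum B j ≢ 0ℤ
    colSum≢0 colSum≡0 = 1≢0 (begin
      1ℤ                                      ≡⟨ idMat-diagonal j ⟨
      idMat j j                               ≡⟨ proj₁ B-inverse j j ⟨
      sumFin (λ l → (idMat -ᴹ A) j l * B l j) ≡⟨ sumFin-cong (λ l → cong ((idMat -ᴹ A) j l *_) (column≡0 l)) ⟩
      sumFin (λ l → (idMat -ᴹ A) j l * 0ℤ)    ≡⟨ sumFin-cong (λ l → ℤₚ.*-zeroʳ ((idMat -ᴹ A) j l)) ⟩
      sumFin {k} (λ _ → 0ℤ)                   ≡⟨ sumFin-zero k ⟩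
      0ℤ                                      ∎)
      where
      column≡0 : ∀ l → B l j ≡ 0ℤ
      column≡0 = sumFin≡0⇒≡0 (λ l → inverse-nonneg l j) colSum≡0
      1≢0 : 1ℤ ≢ 0ℤ
      1≢0 ()

module _ {k} (A B : Mat (suc k)) (A-upper : StrictlyUpper A) (B-inverse : IsInverse (idMat -ᴹ A) B)
         (P-nonneg : ∀ lam → InPA A lam → ∀ i → 0ℤ ≤ lookup lam i) where

  weights : Fin k → ℕ
  weights i = ∣ colSum B (suc i) ∣

  colSum≥1 : ∀ i → 1ℤ ≤ colSum B (suc i)
  colSum≥1 = colSum-positive A B A-upper B-inverse P-nonneg ∘ suc

  +weights : ∀ i → + weights i ≡ colSum B (suc i)
  +weights i = ℤₚ.0≤i⇒+∣i∣≡i (ℤₚ.≤-trans (+≤+ ℕ.z≤n) (colSum≥1 i))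

  weights-nonZero : ∀ i → NonZero (weights i)
  weights-nonZero i = ℕ.>-nonZero (ℤₚ.drop‿+≤+ (subst (1ℤ ≤_) (sym (+weights i)) (colSum≥1 i)))

  slackVector : Vec ℕ k → Fin (suc k) → ℤ
  slackVector v zero    = 0ℤ
  slackVector v (suc j) = + lookup v j

  fromSlack : Vec ℕ k → Vec ℤ (suc k)
  fromSlack v = tabulate (B *ᵥ slackVector v)

  slack-fromSlack : ∀ v → slack A (fromSlack v) ≗ slackVector v
  slack-fromSlack v i = trans (*ᵥ-cong (idMat -ᴹ A) (Vecₚ.lookup∘tabulate (B *ᵥ slackVector v)) i)
                              (*ᵥ-inverse (idMat -ᴹ A) B (proj₁ B-inverse) (slackVector v) i)

  fromSlack-injective : ∀ {v w} → fromSlack v ≡ fromSlack w → v ≡ w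
  fromSlack-injective {v} {w} same-image = begin
    v                    ≡⟨ Vecₚ.tabulate∘lookup v ⟨
    tabulate (lookup v)  ≡⟨ Vecₚ.tabulate-cong lookup≗ ⟩
    tabulate (lookup w)  ≡⟨ Vecₚ.tabulate∘lookup w ⟩
    w                    ∎
    where
    lookup≗ : lookup v ≗ lookup w
    lookup≗ j = ℤₚ.+-injective (begin
      slackVector v (suc j)          ≡⟨ slack-fromSlack v (suc j) ⟨
      slack A (fromSlack v) (suc j)  ≡⟨ cong (λ lam → slack A lam (suc j)) same-image ⟩
      slack A (fromSlack w) (suc j)  ≡⟨ slack-fromSlack w (suc j) ⟩
      slackVector w (suc j)          ∎)

  weight-fromSlack : ∀ v → sumFin (lookup (fromSlack v)) ≡ + weightedSum weights v
  weight-fromSlack v = begin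
    sumFin (lookup (fromSlack v))
      ≡⟨ sumFin-cong (Vecₚ.lookup∘tabulate (B *ᵥ slackVector v)) ⟩
    sumFin (B *ᵥ slackVector v)
      ≡⟨ sumFin-*ᵥ B (slackVector v) ⟩
    colSum B zero * 0ℤ + sumFin (λ j → colSum B (suc j) * + lookup v j)
      ≡⟨ cong₂ _+_ (ℤₚ.*-zeroʳ (colSum B zero))
                   (sumFin-cong (λ j → cong (_* + lookup v j) (sym (+weights j)))) ⟩
    0ℤ + sumFin (λ j → + weights j * + lookup v j)
      ≡⟨ ℤₚ.+-identityˡ _ ⟩
    sumFin (λ j → + weights j * + lookup v j)
      ≡⟨ +weightedSum weights v ⟨
    + weightedSum weights v ∎

  fromSlack-inPAeq : ∀ {n} v → weightedSum weights v ≡ n → InPAeq A n (fromSlack v)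
  fromSlack-inPAeq v weight≡n = Equivalence.from (inPAeq⇔slack A-upper _ (fromSlack v))
    ( (λ i → subst (0ℤ ≤_) (sym (slack-fromSlack v i)) (slackVector-nonneg i))
    , trans (weight-fromSlack v) (cong +_ weight≡n)
    , slack-fromSlack v zero )
    where
    slackVector-nonneg : ∀ i → 0ℤ ≤ slackVector v i
    slackVector-nonneg zero    = +≤+ ℕ.z≤n
    slackVector-nonneg (suc j) = +≤+ ℕ.z≤n

  inPAeq⇒fromSlack : ∀ {n} lam → InPAeq A n lam → ∃ λ v → weightedSum weights v ≡ n × fromSlack v ≡ lam
  inPAeq⇒fromSlack {n} lam lam∈P with Equivalence.to (inPAeq⇔slack A-upper n lam) lam∈P
  ... | slack≥0 , weight≡n , slack₀≡0 = v , weightedSum≡n , fromSlack-v≡lam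
    where
    v : Vec ℕ k
    v = tabulate (λ j → ∣ slack A lam (suc j) ∣)
    slackVector-v : slackVector v ≗ slack A lam
    slackVector-v zero    = sym slack₀≡0
    slackVector-v (suc j) = trans (cong +_ (Vecₚ.lookup∘tabulate (λ j → ∣ slack A lam (suc j) ∣) j))
                                  (ℤₚ.0≤i⇒+∣i∣≡i (slack≥0 (suc j)))
    fromSlack-v≡lam : fromSlack v ≡ lam
    fromSlack-v≡lam = begin
      tabulate (B *ᵥ slackVector v)
        ≡⟨ Vecₚ.tabulate-cong (*ᵥ-cong B slackVector-v) ⟩
      tabulate (B *ᵥ (idMat -ᴹ A) *ᵥ lookup lam)
        ≡⟨ Vecₚ.tabulate-cong (*ᵥ-inverse B (idMat -ᴹ A) (proj₂ B-inverse) (lookup lam)) ⟩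
      tabulate (lookup lam)
        ≡⟨ Vecₚ.tabulate∘lookup lam ⟩
      lam ∎
    weightedSum≡n : weightedSum weights v ≡ n
    weightedSum≡n = ℤₚ.+-injective (begin
      + weightedSum weights v        ≡⟨ weight-fromSlack v ⟨
      sumFin (lookup (fromSlack v))  ≡⟨ cong (sumFin ∘ lookup) fromSlack-v≡lam ⟩
      sumFin (lookup lam)            ≡⟨ weight≡n ⟩
      + n                            ∎)

  ∈-fromSlack-solutions⇔ : ∀ n lam → lam ∈ List.map fromSlack (solutions weights n) ⇔ InPAeq A n lam
  ∈-fromSlack-solutions⇔ n lam = mk⇔
    (λ lam∈ → let v , v∈ , lam≡ = ∈-map⁻ fromSlack lam∈ in
      subst (InPAeq A n) (sym lam≡) (fromSlack-inPAeq v (∈-solutions⁻ weights n v∈)))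
    (λ lam∈P → let v , weight≡n , fromSlack-v≡lam = inPAeq⇒fromSlack lam lam∈P in
      subst (_∈ _) fromSlack-v≡lam (∈-map⁺ fromSlack (∈-solutions⁺ weights weights-nonZero v weight≡n)))

  length-enumeration : ∀ n (L : List (Vec ℤ (suc k))) → Unique L → (∀ lam → (lam ∈ L) ⇔ InPAeq A n lam) →
                       + length L ≡ prodFinS (geomS ∘ weights) n
  length-enumeration n L L! L⇔P = begin
    + length L
      ≡⟨ cong +_ (unique∧set⇒length≡ L! (Uniqueₚ.map⁺ fromSlack-injective (solutions-unique weights n))
                   (λ {lam} → ⇔.trans (L⇔P lam) (⇔.sym (∈-fromSlack-solutions⇔ n lam)))) ⟩
    + length (List.map fromSlack (solutions weights n))
      ≡⟨ cong +_ (Listₚ.length-map fromSlack (solutions weights n)) ⟩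
    + length (solutions weights n)
      ≡⟨ length-solutions weights n ⟩
    prodFinS (geomS ∘ weights) n ∎

corollary1 : (m : ℕ) → (A B : Mat (suc (suc m)))
    → StrictlyUpper A
    → IsInverse (idMat -ᴹ A) B
    → (∀ (lam : Vec ℤ (suc (suc m))) → InPA A lam → ∀ i → + 0 ≤ lookup lam i)
    → (∀ (i : Fin (suc m)) → + 1 ≤ colSum B (suc i))
      × (∀ (n : ℕ) (L : List (Vec ℤ (suc (suc m)))) → Unique L
           → (∀ lam → (lam ∈ L) ⇔ InPAeq A n lam)
           → + length L ≡ prodFinS (λ (i : Fin (suc m)) → geomS ∣ colSum B (suc i) ∣) n)
corollary1 m A B A-upper B-inverse P-nonneg =
  colSum≥1 A B A-upper B-inverse P-nonneg , length-enumeration A B A-upper B-inverse P-nonneg
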